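{- For all finite sequences $S,S'$ of elements of $T(\Sigma\cup\Upsilon,X)$, all $\theta\in\mathit{mgu}(S,S')$ and all $n\in\mathbb N$, we have $\theta(n)\in\mathit{mgu}(S(n),S'(n))$.
   Context: Fix a signature $\Sigma$, hole constants $\square_1,\square_2,\dots$ and an infinite countable set $X$ of variables, pairwise disjoint. A 1-context is a term over $\Sigma\cup\{\square_1,\square_2,\dots\}$ and $X$ containing $\square_1$ and no other hole; $c(s)$ replaces every $\square_1$ by $s$; $c^0=\square_1$, $c^{n+1}=c(c^n)$; $\chi^{(1)}$ is the set of 1-contexts without variables. $\Upsilon$ is a set of new unary function symbols $c^{a,b}$ ($c\in\chi^{(1)}$, $a,b\in\mathbb N$). $T(\Sigma\cup\Upsilon,X)$ and $S(\Sigma\cup\Upsilon,X)$ are the terms and substitutions over $\Sigma\cup\Upsilon$ and $X$; $\mathit{mgu}(S,S')$ is the set of most general unifiers of two sequences of such terms, treating symbols of $\Upsilon$ as ordinary unary function symbols. For $u\in T(\Sigma\cup\Upsilon,X)$ and $n\in\mathbb N$, $u(n)\in T(\Sigma,X)$ is obtained by replacing every symbol $c^{a,b}$ by the nesting $c^{a\times n+b}$; for a sequence $S=\langle u_1,\dots,u_m\rangle$, $S(n)=\langle u_1(n),\dots,u_m(n)\rangle$; for $\theta\in S(\Sigma\cup\Upsilon,X)$, $(\theta(n))(x)=(\theta(x))(n)$ for all $x\in X$. -}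

module Defs where

open import Data.Nat using (ℕ; zero; suc; _+_; _*_; _≤_)
open import Data.Bool using (Bool; true; false; _∨_; T)
open import Data.Vec using (Vec; []; _∷_)
open import Data.List using (List; map)
open import Data.Product using (Σ; ∃; _×_; _,_; proj₁)
open import Relation.Binary.PropositionalEquality using (_≡_)

record Signature : Set₁ where
  field
    Sym   : Set
    arity : Sym → ℕ
open Signature public

module _ (Sig : Signature) where

  -- Variables X are represented by ℕ (an infinite countable set).

  -- Terms over Σ ∪ {□₁} without variables (candidate 1-contexts).
  data Ctx : Set where
    hole : Ctx
    node : (f : Sym Sig) → Vec Ctx (arity Sig f) → Ctx

  mutual
    hasHole : Ctx → Bool
    hasHole hole        = true
    hasHole (node f cs) = hasHoles cs

    hasHoles : ∀ {k} → Vec Ctx k → Bool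
    hasHoles []       = false
    hasHoles (c ∷ cs) = hasHole c ∨ hasHoles cs

  Ctx1 : Set
  Ctx1 = Σ Ctx (λ c → T (hasHole c))

  data Term : Set where
    var : ℕ → Term
    fun : (f : Sym Sig) → Vec Term (arity Sig f) → Term

  -- T(Σ ∪ Υ, X); `ups c a b` is the unary symbol c^{a,b}.
  data UTerm : Set where
    var : ℕ → UTerm
    fun : (f : Sym Sig) → Vec UTerm (arity Sig f) → UTerm
    ups : (c : Ctx1) (a b : ℕ) → UTerm → UTerm

  mutual
    plugC : Ctx → Ctx → Ctx
    plugC hole        d = d
    plugC (node f cs) d = node f (plugCs cs d)

    plugCs : ∀ {k} → Vec Ctx k → Ctx → Vec Ctx k
    plugCs []       d = []
    plugCs (c ∷ cs) d = plugC c d ∷ plugCs cs d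

  mutual
    plug : Ctx → Term → Term
    plug hole        s = s
    plug (node f cs) s = fun f (plugs cs s)

    plugs : ∀ {k} → Vec Ctx k → Term → Vec Term k
    plugs []       s = []
    plugs (c ∷ cs) s = plug c s ∷ plugs cs s

  cpow : Ctx → ℕ → Ctx
  cpow c zero    = hole
  cpow c (suc n) = plugC c (cpow c n)

  mutual
    inst : UTerm → ℕ → Term
    inst (var x)     n = var x
    inst (fun f us)  n = fun f (insts us n)
    inst (ups c a b u) n = plug (cpow (proj₁ c) (a * n + b)) (inst u n)

    insts : ∀ {k} → Vec UTerm k → ℕ → Vec Term k
    insts []       n = []
    insts (u ∷ us) n = inst u n ∷ insts us n

  instSeq : List UTerm → ℕ → List Term
  instSeq S n = map (λ u → inst u n) S

  USubst : Set
  USubst = ℕ → UTerm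

  TSubst : Set
  TSubst = ℕ → Term

  mutual
    applyU : USubst → UTerm → UTerm
    applyU θ (var x)       = θ x
    applyU θ (fun f us)    = fun f (applyUs θ us)
    applyU θ (ups c a b u) = ups c a b (applyU θ u)

    applyUs : ∀ {k} → USubst → Vec UTerm k → Vec UTerm k
    applyUs θ []       = []
    applyUs θ (u ∷ us) = applyU θ u ∷ applyUs θ us

  mutual
    applyT : TSubst → Term → Term
    applyT θ (var x)    = θ x
    applyT θ (fun f ts) = fun f (applyTs θ ts)

    applyTs : ∀ {k} → TSubst → Vec Term k → Vec Term k
    applyTs θ []       = []
    applyTs θ (t ∷ ts) = applyT θ t ∷ applyTs θ ts

  FinDomU : USubst → Set
  FinDomU θ = ∃ λ k → ∀ x → k ≤ x → θ x ≡ var x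

  FinDomT : TSubst → Set
  FinDomT θ = ∃ λ k → ∀ x → k ≤ x → θ x ≡ var x

  instSubst : USubst → ℕ → TSubst
  instSubst θ n x = inst (θ x) n

  -- unifiers of two sequences (sequences of different lengths have none)
  UnifierU : USubst → List UTerm → List UTerm → Set
  UnifierU θ S S' = map (applyU θ) S ≡ map (applyU θ) S'

  UnifierT : TSubst → List Term → List Term → Set
  UnifierT θ S S' = map (applyT θ) S ≡ map (applyT θ) S'

  -- θ ∈ mgu(S,S'): θ is a unifier and every unifier σ equals θη for some η
  -- (θη = first θ, then η)
  IsMguU : USubst → List UTerm → List UTerm → Set
  IsMguU θ S S' =
    FinDomU θ × UnifierU θ S S' ×
    (∀ σ → FinDomU σ → UnifierU σ S S' →
       ∃ λ η → FinDomU η × (∀ x → σ x ≡ applyU η (θ x)))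

  IsMguT : TSubst → List Term → List Term → Set
  IsMguT θ S S' =
    FinDomT θ × UnifierT θ S S' ×
    (∀ σ → FinDomT σ → UnifierT σ S S' →
       ∃ λ η → FinDomT η × (∀ x → σ x ≡ applyT η (θ x)))

-- Run the Martelli–Montanari unification algorithm on the system S ≐ S', treating
-- every c^{a,b} as an ordinary unary symbol. Each rule is also sound for the
-- instances at n: decomposing c^{a,b}(v) ≐ c^{a,b}(v') is, after instantiation,
-- cancelling the common context c^{a n + b}, which is injective because c contains
-- its hole. Hence the algorithm produces a unifier τ of S, S' such that every
-- unifier σ of S(n), S'(n) satisfies σ = σ ∘ τ(n). Since θ is most general,
-- τ = η ∘ θ, so σ = (σ ∘ η(n)) ∘ θ(n).
module Submission where

open import Defs
open import Data.Nat using (ℕ; zero; suc; pred; _+_; _*_; _≤_; _<_; z≤n; s≤s; s≤s⁻¹; _≟_)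
open import Data.Nat.Properties
  using (≤-refl; ≤-trans; 1+n≰n; >⇒≢; m≤m+n; m≤n+m; m≤n⇒m≤1+n; m≤n⇒m≤n+o; m≤n⇒m≤o+n;
         +-monoˡ-≤; +-assoc)
open import Data.List using (List; []; _∷_; map; _++_; zip; length)
open import Data.List.Properties using (∷-injective; length-map; map-∘)
open import Data.List.Relation.Unary.All as All using (All; []; _∷_)
open import Data.List.Relation.Unary.All.Properties using (++⁺; ++⁻ˡ; ++⁻ʳ; map⁺; map⁻)
open import Data.Vec using (Vec; []; _∷_)
import Data.Vec.Properties as Vecₚ
open import Data.Bool using (T)
open import Data.Bool.Properties using (T-∨)
open import Data.Empty using (⊥; ⊥-elim)
open import Data.Product using (Σ; ∃; _×_; _,_; proj₁; proj₂)
open import Data.Sum using (_⊎_; inj₁; inj₂)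
open import Function using (_∘_; _∋_)
open import Function.Bundles using (module Equivalence)
open import Relation.Nullary using (¬_; Dec; yes; no)
open import Relation.Nullary.Decidable using (_⊎-dec_)
open import Relation.Binary.PropositionalEquality
  using (_≡_; refl; sym; trans; cong; cong₂; subst; _≗_; module ≡-Reasoning)

module _ {A B : Set} where

  Unifies : (A → B) → List (A × A) → Set
  Unifies f = All (λ p → f (proj₁ p) ≡ f (proj₂ p))

  unifies-zip : ∀ {f : A → B} S S' → map f S ≡ map f S' → Unifies f (zip S S')
  unifies-zip []      _        _ = []
  unifies-zip (_ ∷ _) []       _ = []
  unifies-zip (l ∷ S) (r ∷ S') e =
    proj₁ (∷-injective e) ∷ unifies-zip S S' (proj₂ (∷-injective e))

  zip-unifies : ∀ {f : A → B} S S' → length S ≡ length S' →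
                Unifies f (zip S S') → map f S ≡ map f S'
  zip-unifies []      []       _   _        = refl
  zip-unifies (l ∷ S) (r ∷ S') len (e ∷ es) =
    cong₂ _∷_ e (zip-unifies S S' (cong pred len) es)

module Unification (Sig : Signature) where

  infixr 5 _⋆ᵘ_ _⋆ᵘ*_ _⋆ᵗ_ _⋆ᵗ*_
  infix  7 _[_] _[_]*
  infixl 8 _^_
  infix  9 _⟨_⟩ _⟨_⟩* _⟨_⟩ˢ

  _⋆ᵘ_ : USubst Sig → UTerm Sig → UTerm Sig
  _⋆ᵘ_ = applyU Sig

  _⋆ᵘ*_ : ∀ {k} → USubst Sig → Vec (UTerm Sig) k → Vec (UTerm Sig) k
  _⋆ᵘ*_ = applyUs Sig

  _⋆ᵗ_ : TSubst Sig → Term Sig → Term Sig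
  _⋆ᵗ_ = applyT Sig

  _⋆ᵗ*_ : ∀ {k} → TSubst Sig → Vec (Term Sig) k → Vec (Term Sig) k
  _⋆ᵗ*_ = applyTs Sig

  _[_] : Ctx Sig → Term Sig → Term Sig
  _[_] = plug Sig

  _[_]* : ∀ {k} → Vec (Ctx Sig) k → Term Sig → Vec (Term Sig) k
  _[_]* = plugs Sig

  _^_ : Ctx Sig → ℕ → Ctx Sig
  _^_ = cpow Sig

  _⟨_⟩ : UTerm Sig → ℕ → Term Sig
  _⟨_⟩ = inst Sig

  _⟨_⟩* : ∀ {k} → Vec (UTerm Sig) k → ℕ → Vec (Term Sig) k
  _⟨_⟩* = insts Sig

  _⟨_⟩ˢ : USubst Sig → ℕ → TSubst Sig
  _⟨_⟩ˢ = instSubst Sig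

  -- Substitution, contexts and instantiation

  mutual
    ⋆ᵗ-∘ : ∀ σ ρ t → σ ⋆ᵗ ρ ⋆ᵗ t ≡ (λ y → σ ⋆ᵗ ρ y) ⋆ᵗ t
    ⋆ᵗ-∘ σ ρ (var x)    = refl
    ⋆ᵗ-∘ σ ρ (fun f ts) = cong (fun f) (⋆ᵗ*-∘ σ ρ ts)

    ⋆ᵗ*-∘ : ∀ {k} σ ρ (ts : Vec (Term Sig) k) → σ ⋆ᵗ* ρ ⋆ᵗ* ts ≡ (λ y → σ ⋆ᵗ ρ y) ⋆ᵗ* ts
    ⋆ᵗ*-∘ σ ρ []       = refl
    ⋆ᵗ*-∘ σ ρ (t ∷ ts) = cong₂ _∷_ (⋆ᵗ-∘ σ ρ t) (⋆ᵗ*-∘ σ ρ ts)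

  mutual
    ⋆ᵗ-cong : ∀ {σ ρ} → σ ≗ ρ → ∀ t → σ ⋆ᵗ t ≡ ρ ⋆ᵗ t
    ⋆ᵗ-cong h (var x)    = h x
    ⋆ᵗ-cong h (fun f ts) = cong (fun f) (⋆ᵗ*-cong h ts)

    ⋆ᵗ*-cong : ∀ {k σ ρ} → σ ≗ ρ → ∀ (ts : Vec (Term Sig) k) → σ ⋆ᵗ* ts ≡ ρ ⋆ᵗ* ts
    ⋆ᵗ*-cong h []       = refl
    ⋆ᵗ*-cong h (t ∷ ts) = cong₂ _∷_ (⋆ᵗ-cong h t) (⋆ᵗ*-cong h ts)

  mutual
    ⋆ᵗ-plug : ∀ σ c s → σ ⋆ᵗ c [ s ] ≡ c [ σ ⋆ᵗ s ]
    ⋆ᵗ-plug σ hole        s = refl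
    ⋆ᵗ-plug σ (node f cs) s = cong (fun f) (⋆ᵗ*-plug σ cs s)

    ⋆ᵗ*-plug : ∀ {k} σ (cs : Vec (Ctx Sig) k) s → σ ⋆ᵗ* cs [ s ]* ≡ cs [ σ ⋆ᵗ s ]*
    ⋆ᵗ*-plug σ []       s = refl
    ⋆ᵗ*-plug σ (c ∷ cs) s = cong₂ _∷_ (⋆ᵗ-plug σ c s) (⋆ᵗ*-plug σ cs s)

  mutual
    plug-plugC : ∀ c d s → plugC Sig c d [ s ] ≡ c [ d [ s ] ]
    plug-plugC hole        d s = refl
    plug-plugC (node f cs) d s = cong (fun f) (plugs-plugCs cs d s)

    plugs-plugCs : ∀ {k} (cs : Vec (Ctx Sig) k) d s → plugCs Sig cs d [ s ]* ≡ cs [ d [ s ] ]*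
    plugs-plugCs []       d s = refl
    plugs-plugCs (c ∷ cs) d s = cong₂ _∷_ (plug-plugC c d s) (plugs-plugCs cs d s)

  fun-injectiveᵗ : ∀ {f} {ts ts' : Vec (Term Sig) (arity Sig f)} →
                   (Term Sig ∋ fun f ts) ≡ fun f ts' → ts ≡ ts'
  fun-injectiveᵗ refl = refl

  mutual
    plug-injective : ∀ c {s s'} → T (hasHole Sig c) → c [ s ] ≡ c [ s' ] → s ≡ s'
    plug-injective hole        _ e = e
    plug-injective (node f cs) h e = plugs-injective cs h (fun-injectiveᵗ e)

    plugs-injective : ∀ {k} (cs : Vec (Ctx Sig) k) {s s'} →
                      T (hasHoles Sig cs) → cs [ s ]* ≡ cs [ s' ]* → s ≡ s'
    plugs-injective (c ∷ cs) h e with Equivalence.to T-∨ h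
    ... | inj₁ h₁ = plug-injective c h₁ (Vecₚ.∷-injectiveˡ e)
    ... | inj₂ h₂ = plugs-injective cs h₂ (Vecₚ.∷-injectiveʳ e)

  plug-^-injective : ∀ c k {s s'} → T (hasHole Sig c) → c ^ k [ s ] ≡ c ^ k [ s' ] → s ≡ s'
  plug-^-injective c zero    h e = e
  plug-^-injective c (suc k) {s} {s'} h e =
    plug-^-injective c k h
      (plug-injective c h (trans (sym (plug-plugC c (c ^ k) s)) (trans e (plug-plugC c (c ^ k) s'))))

  mutual
    ⋆ᵘ-∘ : ∀ θ ρ u → θ ⋆ᵘ ρ ⋆ᵘ u ≡ (λ y → θ ⋆ᵘ ρ y) ⋆ᵘ u
    ⋆ᵘ-∘ θ ρ (var x)       = refl
    ⋆ᵘ-∘ θ ρ (fun f us)    = cong (fun f) (⋆ᵘ*-∘ θ ρ us)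
    ⋆ᵘ-∘ θ ρ (ups c a b u) = cong (ups c a b) (⋆ᵘ-∘ θ ρ u)

    ⋆ᵘ*-∘ : ∀ {k} θ ρ (us : Vec (UTerm Sig) k) → θ ⋆ᵘ* ρ ⋆ᵘ* us ≡ (λ y → θ ⋆ᵘ ρ y) ⋆ᵘ* us
    ⋆ᵘ*-∘ θ ρ []       = refl
    ⋆ᵘ*-∘ θ ρ (u ∷ us) = cong₂ _∷_ (⋆ᵘ-∘ θ ρ u) (⋆ᵘ*-∘ θ ρ us)

  mutual
    ⋆ᵘ-cong : ∀ {θ ρ} → θ ≗ ρ → ∀ u → θ ⋆ᵘ u ≡ ρ ⋆ᵘ u
    ⋆ᵘ-cong h (var x)       = h x
    ⋆ᵘ-cong h (fun f us)    = cong (fun f) (⋆ᵘ*-cong h us)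
    ⋆ᵘ-cong h (ups c a b u) = cong (ups c a b) (⋆ᵘ-cong h u)

    ⋆ᵘ*-cong : ∀ {k θ ρ} → θ ≗ ρ → ∀ (us : Vec (UTerm Sig) k) → θ ⋆ᵘ* us ≡ ρ ⋆ᵘ* us
    ⋆ᵘ*-cong h []       = refl
    ⋆ᵘ*-cong h (u ∷ us) = cong₂ _∷_ (⋆ᵘ-cong h u) (⋆ᵘ*-cong h us)

  mutual
    inst-⋆ᵘ : ∀ θ u n → (θ ⋆ᵘ u) ⟨ n ⟩ ≡ θ ⟨ n ⟩ˢ ⋆ᵗ u ⟨ n ⟩
    inst-⋆ᵘ θ (var x)       n = refl
    inst-⋆ᵘ θ (fun f us)    n = cong (fun f) (inst*-⋆ᵘ* θ us n)
    inst-⋆ᵘ θ (ups c a b u) n =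
      trans (cong (proj₁ c ^ (a * n + b) [_]) (inst-⋆ᵘ θ u n))
            (sym (⋆ᵗ-plug (θ ⟨ n ⟩ˢ) (proj₁ c ^ (a * n + b)) (u ⟨ n ⟩)))

    inst*-⋆ᵘ* : ∀ {k} θ (us : Vec (UTerm Sig) k) n → (θ ⋆ᵘ* us) ⟨ n ⟩* ≡ θ ⟨ n ⟩ˢ ⋆ᵗ* us ⟨ n ⟩*
    inst*-⋆ᵘ* θ []       n = refl
    inst*-⋆ᵘ* θ (u ∷ us) n = cong₂ _∷_ (inst-⋆ᵘ θ u n) (inst*-⋆ᵘ* θ us n)

  ⋆ᵗ-inst-⋆ᵘ : ∀ σ θ u n → σ ⋆ᵗ (θ ⋆ᵘ u) ⟨ n ⟩ ≡ (λ y → σ ⋆ᵗ θ y ⟨ n ⟩) ⋆ᵗ u ⟨ n ⟩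
  ⋆ᵗ-inst-⋆ᵘ σ θ u n = trans (cong (σ ⋆ᵗ_) (inst-⋆ᵘ θ u n)) (⋆ᵗ-∘ σ (θ ⟨ n ⟩ˢ) (u ⟨ n ⟩))

  fun-injectiveᵘ : ∀ {f g} {us : Vec (UTerm Sig) (arity Sig f)}
                   {vs : Vec (UTerm Sig) (arity Sig g)} →
                   (UTerm Sig ∋ fun f us) ≡ fun g vs → Σ (f ≡ g) λ { refl → us ≡ vs }
  fun-injectiveᵘ refl = refl , refl

  ups-injective : ∀ {c c' a a' b b'} {u v : UTerm Sig} → ups c a b u ≡ ups c' a' b' v →
                  c ≡ c' × a ≡ a' × b ≡ b' × u ≡ v
  ups-injective refl = refl , refl , refl , refl

  finite-inst : ∀ {θ} n → FinDomU Sig θ → FinDomT Sig (θ ⟨ n ⟩ˢ)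
  finite-inst n (k , fin) = k , λ x k≤x → cong (_⟨ n ⟩) (fin x k≤x)

  finite-⋆ᵘ-∘ : ∀ {ρ θ} → FinDomU Sig ρ → FinDomU Sig θ → FinDomU Sig (λ y → ρ ⋆ᵘ θ y)
  finite-⋆ᵘ-∘ {ρ} (k' , finρ) (k , finθ) = k + k' , λ y le →
    trans (cong (ρ ⋆ᵘ_) (finθ y (≤-trans (m≤m+n k k') le))) (finρ y (≤-trans (m≤n+m k' k) le))

  finite-⋆ᵗ-∘ : ∀ {σ θ} → FinDomT Sig σ → FinDomT Sig θ → FinDomT Sig (λ y → σ ⋆ᵗ θ y)
  finite-⋆ᵗ-∘ {σ} (k' , finσ) (k , finθ) = k + k' , λ y le →
    trans (cong (σ ⋆ᵗ_) (finθ y (≤-trans (m≤m+n k k') le))) (finσ y (≤-trans (m≤n+m k' k) le))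

  _↦_ : ℕ → UTerm Sig → USubst Sig
  (x ↦ t) y with y ≟ x
  ... | yes _ = t
  ... | no  _ = var y

  ↦-self : ∀ x t → (x ↦ t) x ≡ t
  ↦-self x t with x ≟ x
  ... | yes _   = refl
  ... | no  x≢x = ⊥-elim (x≢x refl)

  ↦-other : ∀ {x y} t → ¬ y ≡ x → (x ↦ t) y ≡ var y
  ↦-other {x} {y} t y≢x with y ≟ x
  ... | yes y≡x = ⊥-elim (y≢x y≡x)
  ... | no  _   = refl

  ↦-absorbed : ∀ {C : Set} (F : UTerm Sig → C) {x t} → F (var x) ≡ F t →
               ∀ y → F ((x ↦ t) y) ≡ F (var y)
  ↦-absorbed F {x} e y with y ≟ x
  ... | yes refl = sym e
  ... | no  _    = refl

  finite-↦ : ∀ x t → FinDomU Sig (x ↦ t)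
  finite-↦ x t = suc x , λ y x<y → ↦-other t (>⇒≢ x<y)

  ⋆ᵘ-↦ : ∀ θ {x t} → θ x ≡ θ ⋆ᵘ t → ∀ u → θ ⋆ᵘ (x ↦ t) ⋆ᵘ u ≡ θ ⋆ᵘ u
  ⋆ᵘ-↦ θ e u = trans (⋆ᵘ-∘ θ _ u) (⋆ᵘ-cong (↦-absorbed (θ ⋆ᵘ_) e) u)

  ⋆ᵗ-↦ : ∀ n σ {x t} → σ x ≡ σ ⋆ᵗ t ⟨ n ⟩ → ∀ u → σ ⋆ᵗ ((x ↦ t) ⋆ᵘ u) ⟨ n ⟩ ≡ σ ⋆ᵗ u ⟨ n ⟩
  ⋆ᵗ-↦ n σ e u =
    trans (⋆ᵗ-inst-⋆ᵘ σ _ u n) (⋆ᵗ-cong (↦-absorbed (λ v → σ ⋆ᵗ v ⟨ n ⟩) e) (u ⟨ n ⟩))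

  mutual
    Occurs : ℕ → UTerm Sig → Set
    Occurs x (var y)       = y ≡ x
    Occurs x (fun f us)    = Occurs* x us
    Occurs x (ups c a b u) = Occurs x u

    Occurs* : ∀ {k} → ℕ → Vec (UTerm Sig) k → Set
    Occurs* x []       = ⊥
    Occurs* x (u ∷ us) = Occurs x u ⊎ Occurs* x us

  mutual
    occurs? : ∀ x u → Dec (Occurs x u)
    occurs? x (var y)       = y ≟ x
    occurs? x (fun f us)    = occurs*? x us
    occurs? x (ups c a b u) = occurs? x u

    occurs*? : ∀ {k} x (us : Vec (UTerm Sig) k) → Dec (Occurs* x us)
    occurs*? x []       = no λ ()
    occurs*? x (u ∷ us) = occurs? x u ⊎-dec occurs*? x us

  mutual
    ⋆ᵘ-fresh : ∀ {x} t u → ¬ Occurs x u → (x ↦ t) ⋆ᵘ u ≡ u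
    ⋆ᵘ-fresh t (var y)       x∉u = ↦-other t x∉u
    ⋆ᵘ-fresh t (fun f us)    x∉u = cong (fun f) (⋆ᵘ*-fresh t us x∉u)
    ⋆ᵘ-fresh t (ups c a b u) x∉u = cong (ups c a b) (⋆ᵘ-fresh t u x∉u)

    ⋆ᵘ*-fresh : ∀ {k x} t (us : Vec (UTerm Sig) k) → ¬ Occurs* x us → (x ↦ t) ⋆ᵘ* us ≡ us
    ⋆ᵘ*-fresh t []       _   = refl
    ⋆ᵘ*-fresh t (u ∷ us) x∉u =
      cong₂ _∷_ (⋆ᵘ-fresh t u (x∉u ∘ inj₁)) (⋆ᵘ*-fresh t us (x∉u ∘ inj₂))

  mutual
    size : UTerm Sig → ℕ
    size (var x)       = 1
    size (fun f us)    = suc (size* us)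
    size (ups c a b u) = suc (size u)

    size* : ∀ {k} → Vec (UTerm Sig) k → ℕ
    size* []       = 0
    size* (u ∷ us) = size u + size* us

  size-pos : ∀ u → 1 ≤ size u
  size-pos (var x)       = ≤-refl
  size-pos (fun f us)    = s≤s z≤n
  size-pos (ups c a b u) = s≤s z≤n

  mutual
    occurs-size : ∀ θ {x} u → Occurs x u → size (θ x) ≤ size (θ ⋆ᵘ u)
    occurs-size θ (var y)       refl = ≤-refl
    occurs-size θ (fun f us)    x∈u  = m≤n⇒m≤1+n (occurs*-size θ us x∈u)
    occurs-size θ (ups c a b u) x∈u  = m≤n⇒m≤1+n (occurs-size θ u x∈u)

    occurs*-size : ∀ {k} θ {x} (us : Vec (UTerm Sig) k) → Occurs* x us →
                   size (θ x) ≤ size* (θ ⋆ᵘ* us)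
    occurs*-size θ (u ∷ us) (inj₁ x∈u)  = m≤n⇒m≤n+o (size* (θ ⋆ᵘ* us)) (occurs-size θ u x∈u)
    occurs*-size θ (u ∷ us) (inj₂ x∈us) = m≤n⇒m≤o+n (size (θ ⋆ᵘ u)) (occurs*-size θ us x∈us)

  occurs-unified⇒var : ∀ θ {x} t → Occurs x t → θ x ≡ θ ⋆ᵘ t → t ≡ var x
  occurs-unified⇒var θ (var y)       x∈t e = cong var x∈t
  occurs-unified⇒var θ (fun f us)    x∈t e =
    ⊥-elim (1+n≰n (subst (λ s → size s ≤ size* (θ ⋆ᵘ* us)) e (occurs*-size θ us x∈t)))
  occurs-unified⇒var θ (ups c a b u) x∈t e =
    ⊥-elim (1+n≰n (subst (λ s → size s ≤ size (θ ⋆ᵘ u)) e (occurs-size θ u x∈t)))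

  -- Unification

  Eqs : Set
  Eqs = List (UTerm Sig × UTerm Sig)

  substEqs : USubst Sig → Eqs → Eqs
  substEqs ρ = map (λ p → ρ ⋆ᵘ proj₁ p , ρ ⋆ᵘ proj₂ p)

  argEqs : ∀ {k} → Vec (UTerm Sig) k → Vec (UTerm Sig) k → Eqs
  argEqs []       []       = []
  argEqs (u ∷ us) (v ∷ vs) = (u , v) ∷ argEqs us vs

  -- The fuel of `solve` bounds the total size of the left-hand sides under a fixed
  -- unifier θ. Binding x ↦ t leaves this unchanged on the rest of the system, as θ
  -- already identifies x with t; every other step strictly decreases it.
  weight : USubst Sig → Eqs → ℕ
  weight θ []            = 0
  weight θ ((l , _) ∷ E) = size (θ ⋆ᵘ l) + weight θ E

  weight-tail : ∀ θ l E {m} → size (θ ⋆ᵘ l) + weight θ E < suc m → weight θ E < m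
  weight-tail θ l E lt = ≤-trans (+-monoˡ-≤ (weight θ E) (size-pos (θ ⋆ᵘ l))) (s≤s⁻¹ lt)

  weight-argEqs-++ : ∀ {k} θ (us vs : Vec (UTerm Sig) k) E →
                     weight θ (argEqs us vs ++ E) ≡ size* (θ ⋆ᵘ* us) + weight θ E
  weight-argEqs-++ θ []       []       E = refl
  weight-argEqs-++ θ (u ∷ us) (v ∷ vs) E =
    trans (cong (size (θ ⋆ᵘ u) +_) (weight-argEqs-++ θ us vs E))
          (sym (+-assoc (size (θ ⋆ᵘ u)) _ _))

  weight-substEqs : ∀ θ {ρ} → (∀ u → θ ⋆ᵘ ρ ⋆ᵘ u ≡ θ ⋆ᵘ u) →
                    ∀ E → weight θ (substEqs ρ E) ≡ weight θ E
  weight-substEqs θ h []            = refl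
  weight-substEqs θ h ((l , _) ∷ E) = cong₂ _+_ (cong size (h l)) (weight-substEqs θ h E)

  module _ {C : Set} {f g : UTerm Sig → C} {ρ : USubst Sig} (h : ∀ u → f (ρ ⋆ᵘ u) ≡ g u) where

    unifies-substEqs : ∀ {E} → Unifies g E → Unifies f (substEqs ρ E)
    unifies-substEqs = map⁺ ∘ All.map λ e → trans (h _) (trans e (sym (h _)))

    substEqs-unifies : ∀ {E} → Unifies f (substEqs ρ E) → Unifies g E
    substEqs-unifies = All.map (λ e → trans (sym (h _)) (trans e (h _))) ∘ map⁻

  unifies-argEqs : ∀ {k} θ (us vs : Vec (UTerm Sig) k) →
                   θ ⋆ᵘ* us ≡ θ ⋆ᵘ* vs → Unifies (θ ⋆ᵘ_) (argEqs us vs)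
  unifies-argEqs θ []       []       e = []
  unifies-argEqs θ (u ∷ us) (v ∷ vs) e =
    Vecₚ.∷-injectiveˡ e ∷ unifies-argEqs θ us vs (Vecₚ.∷-injectiveʳ e)

  argEqs-unifies : ∀ {k} θ (us vs : Vec (UTerm Sig) k) →
                   Unifies (θ ⋆ᵘ_) (argEqs us vs) → θ ⋆ᵘ* us ≡ θ ⋆ᵘ* vs
  argEqs-unifies θ []       []       []       = refl
  argEqs-unifies θ (u ∷ us) (v ∷ vs) (e ∷ es) = cong₂ _∷_ e (argEqs-unifies θ us vs es)

  unifies-inst-argEqs : ∀ {k} n σ (us vs : Vec (UTerm Sig) k) →
                        σ ⋆ᵗ* us ⟨ n ⟩* ≡ σ ⋆ᵗ* vs ⟨ n ⟩* → Unifies (λ u → σ ⋆ᵗ u ⟨ n ⟩) (argEqs us vs)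
  unifies-inst-argEqs n σ []       []       e = []
  unifies-inst-argEqs n σ (u ∷ us) (v ∷ vs) e =
    Vecₚ.∷-injectiveˡ e ∷ unifies-inst-argEqs n σ us vs (Vecₚ.∷-injectiveʳ e)

  record Solved (n : ℕ) (E : Eqs) : Set where
    constructor solved
    field
      τ        : USubst Sig
      finite   : FinDomU Sig τ
      unifies  : Unifies (τ ⋆ᵘ_) E
      absorbed : ∀ σ → Unifies (λ u → σ ⋆ᵗ u ⟨ n ⟩) E → ∀ y → σ y ≡ σ ⋆ᵗ τ y ⟨ n ⟩

  solved-[] : ∀ n → Solved n []
  solved-[] n = solved var (0 , λ _ _ → refl) [] λ _ _ _ → refl

  solved-trivial : ∀ {n l E} → Solved n E → Solved n ((l , l) ∷ E)
  solved-trivial (solved τ fin un ab) = solved τ fin (refl ∷ un) λ { σ (_ ∷ uE) → ab σ uE }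

  solved-swap : ∀ {n l r E} → Solved n ((l , r) ∷ E) → Solved n ((r , l) ∷ E)
  solved-swap (solved τ fin (e ∷ un) ab) =
    solved τ fin (sym e ∷ un) λ { σ (e' ∷ uE) → ab σ (sym e' ∷ uE) }

  solved-fun : ∀ {n f E} {us vs : Vec (UTerm Sig) (arity Sig f)} →
               Solved n (argEqs us vs ++ E) → Solved n ((fun f us , fun f vs) ∷ E)
  solved-fun {n} {us = us} {vs} (solved τ fin un ab) =
    solved τ fin
      (cong (fun _) (argEqs-unifies τ us vs (++⁻ˡ (argEqs us vs) un)) ∷ ++⁻ʳ (argEqs us vs) un)
      λ { σ (e ∷ uE) → ab σ (++⁺ (unifies-inst-argEqs n σ us vs (fun-injectiveᵗ e)) uE) }

  solved-ups : ∀ {n c a b v v' E} →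
               Solved n ((v , v') ∷ E) → Solved n ((ups c a b v , ups c a b v') ∷ E)
  solved-ups {n} {c , hole∈c} {a} {b} {v} {v'} (solved τ fin (e ∷ un) ab) =
    solved τ fin (cong (ups _ a b) e ∷ un) λ { σ (e' ∷ uE) → ab σ (cancel σ e' ∷ uE) }
    where
      cₙ = c ^ (a * n + b)
      cancel : ∀ σ → σ ⋆ᵗ cₙ [ v ⟨ n ⟩ ] ≡ σ ⋆ᵗ cₙ [ v' ⟨ n ⟩ ] → σ ⋆ᵗ v ⟨ n ⟩ ≡ σ ⋆ᵗ v' ⟨ n ⟩
      cancel σ e' = plug-^-injective c (a * n + b) hole∈c
        (trans (sym (⋆ᵗ-plug σ cₙ (v ⟨ n ⟩))) (trans e' (⋆ᵗ-plug σ cₙ (v' ⟨ n ⟩))))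

  solved-elim : ∀ {n x t E} → ¬ Occurs x t →
                Solved n (substEqs (x ↦ t) E) → Solved n ((var x , t) ∷ E)
  solved-elim {n} {x} {t} {E} x∉t (solved τ' fin un ab) =
    solved τ (finite-⋆ᵘ-∘ fin (finite-↦ x t)) (τx≡τt ∷ substEqs-unifies (⋆ᵘ-∘ τ' _) un) absorbed
    where
      τ : USubst Sig
      τ y = τ' ⋆ᵘ (x ↦ t) y

      τx≡τt : τ x ≡ τ ⋆ᵘ t
      τx≡τt = begin
        τ' ⋆ᵘ (x ↦ t) x      ≡⟨ cong (τ' ⋆ᵘ_) (↦-self x t) ⟩
        τ' ⋆ᵘ t              ≡⟨ cong (τ' ⋆ᵘ_) (⋆ᵘ-fresh t t x∉t) ⟨
        τ' ⋆ᵘ (x ↦ t) ⋆ᵘ t   ≡⟨ ⋆ᵘ-∘ τ' (x ↦ t) t ⟩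
        τ ⋆ᵘ t               ∎
        where open ≡-Reasoning

      absorbed : ∀ σ → Unifies (λ u → σ ⋆ᵗ u ⟨ n ⟩) ((var x , t) ∷ E) →
                 ∀ y → σ y ≡ σ ⋆ᵗ τ y ⟨ n ⟩
      absorbed σ (e ∷ uE) y = sym (begin
        σ ⋆ᵗ (τ' ⋆ᵘ (x ↦ t) y) ⟨ n ⟩                  ≡⟨ ⋆ᵗ-inst-⋆ᵘ σ τ' ((x ↦ t) y) n ⟩
        (λ z → σ ⋆ᵗ τ' z ⟨ n ⟩) ⋆ᵗ (x ↦ t) y ⟨ n ⟩  ≡⟨ ⋆ᵗ-cong (sym ∘ ab σ uE') ((x ↦ t) y ⟨ n ⟩) ⟩
        σ ⋆ᵗ (x ↦ t) y ⟨ n ⟩                         ≡⟨ ↦-absorbed (λ u → σ ⋆ᵗ u ⟨ n ⟩) e y ⟩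
        σ y                                           ∎)
        where
          open ≡-Reasoning
          uE' = unifies-substEqs (⋆ᵗ-↦ n σ e) uE

  mutual
    solve : ∀ n m E θ → Unifies (θ ⋆ᵘ_) E → weight θ E < m → Solved n E
    solve n zero    E θ _ ()
    solve n (suc m) [] θ _ _ = solved-[] n
    solve n (suc m) ((var x , t) ∷ E) θ (e ∷ uE) lt =
      solveVar n m x t E θ e uE (weight-tail θ (var x) E lt)
    solve n (suc m) ((t@(fun _ _) , var x) ∷ E) θ (e ∷ uE) lt =
      solved-swap (solveVar n m x t E θ (sym e) uE (weight-tail θ t E lt))
    solve n (suc m) ((t@(ups _ _ _ _) , var x) ∷ E) θ (e ∷ uE) lt =
      solved-swap (solveVar n m x t E θ (sym e) uE (weight-tail θ t E lt))
    solve n (suc m) ((fun _ _ , ups _ _ _ _) ∷ E) θ (() ∷ _) _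
    solve n (suc m) ((ups _ _ _ _ , fun _ _) ∷ E) θ (() ∷ _) _
    solve n (suc m) ((fun f us , fun g vs) ∷ E) θ (e ∷ uE) lt with fun-injectiveᵘ e
    ... | refl , e' =
      solved-fun (solve n m (argEqs us vs ++ E) θ (++⁺ (unifies-argEqs θ us vs e') uE)
        (subst (_< m) (sym (weight-argEqs-++ θ us vs E)) (s≤s⁻¹ lt)))
    solve n (suc m) ((ups c a b u , ups c' a' b' v) ∷ E) θ (e ∷ uE) lt with ups-injective e
    ... | refl , refl , refl , e' = solved-ups (solve n m ((u , v) ∷ E) θ (e' ∷ uE) (s≤s⁻¹ lt))

    solveVar : ∀ n m x t E θ → θ x ≡ θ ⋆ᵘ t → Unifies (θ ⋆ᵘ_) E → weight θ E < m →
               Solved n ((var x , t) ∷ E)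
    solveVar n m x t E θ e uE lt with occurs? x t
    ... | yes x∈t with occurs-unified⇒var θ t x∈t e
    ...   | refl = solved-trivial (solve n m E θ uE lt)
    solveVar n m x t E θ e uE lt | no x∉t =
      solved-elim x∉t (solve n m (substEqs (x ↦ t) E) θ (unifies-substEqs (⋆ᵘ-↦ θ e) uE)
        (subst (_< m) (sym (weight-substEqs θ (⋆ᵘ-↦ θ e) E)) lt))

  instSeq-⋆ᵘ : ∀ θ n S → map (θ ⟨ n ⟩ˢ ⋆ᵗ_) (instSeq Sig S n) ≡ instSeq Sig (map (θ ⋆ᵘ_) S) n
  instSeq-⋆ᵘ θ n []      = refl
  instSeq-⋆ᵘ θ n (u ∷ S) = cong₂ _∷_ (sym (inst-⋆ᵘ θ u n)) (instSeq-⋆ᵘ θ n S)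

  instSubst-unifier : ∀ n θ S S' → UnifierU Sig θ S S' →
                      UnifierT Sig (θ ⟨ n ⟩ˢ) (instSeq Sig S n) (instSeq Sig S' n)
  instSubst-unifier n θ S S' e =
    trans (instSeq-⋆ᵘ θ n S) (trans (cong (λ T → instSeq Sig T n) e) (sym (instSeq-⋆ᵘ θ n S')))

  absorbing-unifier : ∀ n S S' θ → UnifierU Sig θ S S' →
    ∃ λ τ → FinDomU Sig τ × UnifierU Sig τ S S' ×
      (∀ σ → UnifierT Sig σ (instSeq Sig S n) (instSeq Sig S' n) → ∀ y → σ y ≡ σ ⋆ᵗ τ y ⟨ n ⟩)
  absorbing-unifier n S S' θ e = τ , finite , zip-unifies S S' sameLength unifies , absorbed-seq
    where
      open Solved (solve n (suc (weight θ (zip S S'))) (zip S S') θ (unifies-zip S S' e) ≤-refl)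
      sameLength : length S ≡ length S'
      sameLength = trans (sym (length-map (θ ⋆ᵘ_) S)) (trans (cong length e) (length-map (θ ⋆ᵘ_) S'))

      absorbed-seq : ∀ σ → UnifierT Sig σ (instSeq Sig S n) (instSeq Sig S' n) →
                     ∀ y → σ y ≡ σ ⋆ᵗ τ y ⟨ n ⟩
      absorbed-seq σ eσ =
        absorbed σ (unifies-zip S S' (trans (map-∘ S) (trans eσ (sym (map-∘ S')))))

  instSubst-most-general : ∀ n S S' θ → UnifierU Sig θ S S' →
    (∀ τ → FinDomU Sig τ → UnifierU Sig τ S S' → ∃ λ η → FinDomU Sig η × (∀ x → τ x ≡ η ⋆ᵘ θ x)) →
    ∀ σ → FinDomT Sig σ → UnifierT Sig σ (instSeq Sig S n) (instSeq Sig S' n) →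
    ∃ λ η → FinDomT Sig η × (∀ x → σ x ≡ η ⋆ᵗ (θ ⟨ n ⟩ˢ) x)
  instSubst-most-general n S S' θ e mostGeneral σ finσ eσ
    with absorbing-unifier n S S' θ e
  ... | τ , finτ , eτ , absorbed with mostGeneral τ finτ eτ
  ... | η , finη , τ≡ηθ =
    (λ y → σ ⋆ᵗ η y ⟨ n ⟩) , finite-⋆ᵗ-∘ finσ (finite-inst n finη) , λ x → begin
      σ x                                     ≡⟨ absorbed σ eσ x ⟩
      σ ⋆ᵗ τ x ⟨ n ⟩                          ≡⟨ cong (λ u → σ ⋆ᵗ u ⟨ n ⟩) (τ≡ηθ x) ⟩
      σ ⋆ᵗ (η ⋆ᵘ θ x) ⟨ n ⟩                   ≡⟨ ⋆ᵗ-inst-⋆ᵘ σ η (θ x) n ⟩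
      (λ y → σ ⋆ᵗ η y ⟨ n ⟩) ⋆ᵗ θ x ⟨ n ⟩     ∎
    where open ≡-Reasoning

open Unification

lemmaA6 : (Sig : Signature) (S S' : List (UTerm Sig)) (θ : USubst Sig) →
    IsMguU Sig θ S S' →
    (n : ℕ) → IsMguT Sig (instSubst Sig θ n) (instSeq Sig S n) (instSeq Sig S' n)
lemmaA6 Sig S S' θ (finθ , e , mostGeneral) n =
  finite-inst Sig n finθ ,
  instSubst-unifier Sig n θ S S' e ,
  instSubst-most-general Sig n S S' θ e mostGeneral
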